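{- Let $k\ge 3$ and let $K_1,K_2,K_3$ be three pairwise disjoint $k$-spaces in $\mathrm{PG}(v-1,2)$. Let $\mathcal{L}$ be the set of lines that intersect each $K_i$ in exactly one point. Then the lines in $\mathcal{L}$ are pairwise disjoint, and for each $1\le i\le 3$ the set $\{L\cap K_i : L\in\mathcal{L}\}$ forms a subspace.
   Context: A $k$-space is a $k$-dimensional subspace of $\mathbb{F}_2^v$, viewed in $\mathrm{PG}(v-1,2)$; lines are $2$-spaces; disjoint means having trivial intersection (no common point). -}

module Defs where

open import Data.Bool using (Bool; true; false; _xor_; _∧_)
open import Data.Nat using (ℕ; zero; suc)
open import Data.Vec using (Vec; []; _∷_; zipWith; replicate)
open import Data.Product using (Σ; ∃; _×_; _,_)
open import Data.Sum using (_⊎_)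
open import Relation.Binary.PropositionalEquality using (_≡_; _≢_)
open import Level using (Level) renaming (suc to lsuc; zero to lzero)

-- Vectors of F₂^v, with F₂ = Bool (addition = xor, multiplication = ∧).
V : ℕ → Set
V v = Vec Bool v

𝟎 : ∀ {v} → V v
𝟎 = replicate _ false

infixl 6 _⊕_
_⊕_ : ∀ {v} → V v → V v → V v
_⊕_ = zipWith _xor_

_·_ : ∀ {v} → Bool → V v → V v
true  · x = x
false · x = 𝟎

comb : ∀ {v k} → Vec Bool k → Vec (V v) k → V v
comb []       []       = 𝟎
comb (c ∷ cs) (b ∷ bs) = (c · b) ⊕ comb cs bs

Subset : ℕ → Set₁
Subset v = V v → Set

LinearlyIndependent : ∀ {v k} → Vec (V v) k → Set
LinearlyIndependent {k = k} b = ∀ (c : Vec Bool k) → comb c b ≡ 𝟎 → c ≡ replicate k false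

Spans : ∀ {v k} → Vec (V v) k → Subset v → Set
Spans {k = k} b S = ∀ x → (S x → ∃ λ (c : Vec Bool k) → comb c b ≡ x)
                        × ((∃ λ (c : Vec Bool k) → comb c b ≡ x) → S x)

-- S is a k-space: a k-dimensional subspace of F₂^v (it has a basis of size k)
IsKSpace : ∀ {v} → ℕ → Subset v → Set
IsKSpace {v} k S = Σ (Vec (V v) k) λ b → LinearlyIndependent b × Spans b S

-- S is a subspace of F₂^v (over F₂, closure under addition suffices)
-- (level-polymorphic so that sets defined by quantifying over lines can be used)
IsSubspace : ∀ {v} {ℓ : Level} → (V v → Set ℓ) → Set ℓ
IsSubspace S = S 𝟎 × (∀ x y → S x → S y → S (x ⊕ y))

-- Points of PG(v-1,2) are the nonzero vectors.
-- Two subspaces are disjoint if they share no point (trivial intersection).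
Disjoint : ∀ {v} → Subset v → Subset v → Set
Disjoint A B = ∀ x → A x → B x → x ≡ 𝟎

SameSet : ∀ {v} → Subset v → Subset v → Set
SameSet A B = ∀ x → (A x → B x) × (B x → A x)

MeetsInExactlyOnePoint : ∀ {v} → Subset v → Subset v → Set
MeetsInExactlyOnePoint L K =
  Σ _ λ p → p ≢ 𝟎 × L p × K p × (∀ q → q ≢ 𝟎 → L q → K q → q ≡ p)

IsLine : ∀ {v} → Subset v → Set
IsLine = IsKSpace 2

{-# OPTIONS --safe #-}
module Submission where

-- Let T be the set of triples (p₀ , p₁ , p₂) ∈ K₀ × K₁ × K₂ with p₀ + p₁ = p₂; it is closed
-- under addition. Since the Kᵢ are pairwise disjoint, an element of T with one zero coordinate
-- has two equal coordinates lying in different Kᵢ, so it is zero: every element of T is zero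
-- or nowhere zero. A line over F₂ has exactly three points, which sum to zero, so the
-- transversal lines are exactly the lines {p₀ , p₁ , p₂} of the nowhere-zero elements of T.
-- If two transversals share a point, their difference in T vanishes at one coordinate, hence
-- everywhere, and the lines coincide. The set of points in which transversals meet Kᵢ is,
-- together with 0, the i-th projection of T, hence a subspace.

open import Defs
open import Data.Nat using (ℕ; _≥_)
open import Data.Fin using (Fin)
open import Data.Product using (Σ; _×_)
open import Data.Sum using (_⊎_)
open import Relation.Nullary using (¬_)
open import Relation.Binary.PropositionalEquality using (_≡_; _≢_)

open import Algebra.Bundles using (AbelianGroup)
import Algebra.Properties.AbelianGroup as AbelianGroupProperties
import Algebra.Properties.CommutativeSemigroup as CommutativeSemigroupProperties
open import Data.Bool using (true; false; _xor_)
open import Data.Bool.Properties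
  using (xor-assoc; xor-comm; xor-identityˡ; xor-identityʳ; xor-same) renaming (_≟_ to _≟ᵇ_)
open import Data.Fin.Patterns using (0F; 1F; 2F)
open import Data.Fin.Properties using () renaming (_≟_ to _≟ᶠ_)
open import Data.Product using (_,_; proj₁; proj₂; ∃-syntax)
open import Data.Sum using (inj₁; inj₂)
open import Data.Vec using (Vec; []; _∷_)
open import Data.Vec.Properties
  using (≡-dec; zipWith-assoc; zipWith-comm; zipWith-identityˡ; zipWith-identityʳ)
open import Level using (0ℓ)
open import Relation.Binary.Definitions using (DecidableEquality)
open import Relation.Binary.PropositionalEquality
  using (refl; sym; trans; cong; cong₂; subst; ≢-sym)
open import Relation.Binary.PropositionalEquality.Algebra using (isMagma)
open import Relation.Nullary using (yes; no; contradiction)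

module _ {v : ℕ} where

  ⊕-assoc : (x y z : V v) → (x ⊕ y) ⊕ z ≡ x ⊕ (y ⊕ z)
  ⊕-assoc = zipWith-assoc xor-assoc

  ⊕-comm : (x y : V v) → x ⊕ y ≡ y ⊕ x
  ⊕-comm = zipWith-comm xor-comm

  ⊕-identityˡ : (x : V v) → 𝟎 ⊕ x ≡ x
  ⊕-identityˡ = zipWith-identityˡ xor-identityˡ

  ⊕-identityʳ : (x : V v) → x ⊕ 𝟎 ≡ x
  ⊕-identityʳ = zipWith-identityʳ xor-identityʳ

  _≟ᵛ_ : DecidableEquality (V v)
  _≟ᵛ_ = ≡-dec _≟ᵇ_

⊕-self : ∀ {v} (x : V v) → x ⊕ x ≡ 𝟎
⊕-self []      = refl
⊕-self (a ∷ x) = cong₂ _∷_ (xor-same a) (⊕-self x)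

⊕-abelianGroup : ℕ → AbelianGroup 0ℓ 0ℓ
⊕-abelianGroup v = record
  { Carrier        = V v
  ; _≈_            = _≡_
  ; _∙_            = _⊕_
  ; ε              = 𝟎
  ; _⁻¹            = λ x → x
  ; isAbelianGroup = record
    { isGroup = record
      { isMonoid = record
        { isSemigroup = record { isMagma = isMagma _⊕_ ; assoc = ⊕-assoc }
        ; identity    = ⊕-identityˡ , ⊕-identityʳ
        }
      ; inverse = ⊕-self , ⊕-self
      ; ⁻¹-cong = λ x≡y → x≡y
      }
    ; comm = ⊕-comm
    }
  }

module _ {v : ℕ} where
  open AbelianGroup (⊕-abelianGroup v) using (commutativeSemigroup)
  open AbelianGroupProperties (⊕-abelianGroup v) using (inverseˡ-unique)
  open CommutativeSemigroupProperties commutativeSemigroup using (interchange)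

  ⊕-interchange : (w x y z : V v) → (w ⊕ x) ⊕ (y ⊕ z) ≡ (w ⊕ y) ⊕ (x ⊕ z)
  ⊕-interchange = interchange

  x⊕y≡𝟎⇒x≡y : {x y : V v} → x ⊕ y ≡ 𝟎 → x ≡ y
  x⊕y≡𝟎⇒x≡y = inverseˡ-unique _ _

·-distribʳ-xor : ∀ {v} a b (x : V v) → (a xor b) · x ≡ a · x ⊕ b · x
·-distribʳ-xor true  true  x = sym (⊕-self x)
·-distribʳ-xor true  false x = sym (⊕-identityʳ x)
·-distribʳ-xor false true  x = sym (⊕-identityˡ x)
·-distribʳ-xor false false x = sym (⊕-identityˡ 𝟎)

comb-𝟎 : ∀ {v k} (bs : Vec (V v) k) → comb 𝟎 bs ≡ 𝟎
comb-𝟎 []       = refl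
comb-𝟎 (b ∷ bs) = trans (⊕-identityˡ _) (comb-𝟎 bs)

comb-⊕ : ∀ {v k} (c d : V k) (bs : Vec (V v) k) → comb (c ⊕ d) bs ≡ comb c bs ⊕ comb d bs
comb-⊕ []       []       []       = sym (⊕-identityˡ 𝟎)
comb-⊕ (c ∷ cs) (d ∷ ds) (b ∷ bs) =
  trans (cong₂ _⊕_ (·-distribʳ-xor c d b) (comb-⊕ cs ds bs)) (⊕-interchange _ _ _ _)

Span : ∀ {v k} → Vec (V v) k → Subset v
Span bs x = ∃[ c ] comb c bs ≡ x

span-isSubspace : ∀ {v k} (bs : Vec (V v) k) → IsSubspace (Span bs)
span-isSubspace bs = (𝟎 , comb-𝟎 bs) , λ { _ _ (c , refl) (d , refl) → c ⊕ d , comb-⊕ c d bs }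

isSubspace-transport : ∀ {v a b} {A : V v → Set a} {B : V v → Set b} →
                       (∀ {x} → A x → B x) → (∀ {x} → B x → A x) → IsSubspace A → IsSubspace B
isSubspace-transport A⊆B B⊆A (A𝟎 , A-⊕) = A⊆B A𝟎 , λ x y Bx By → A⊆B (A-⊕ x y (B⊆A Bx) (B⊆A By))

isKSpace⇒isSubspace : ∀ {v k} {S : Subset v} → IsKSpace k S → IsSubspace S
isKSpace⇒isSubspace (bs , _ , spans) =
  isSubspace-transport (proj₂ (spans _)) (proj₁ (spans _)) (span-isSubspace bs)

pattern ⟨00⟩ = false ∷ false ∷ []
pattern ⟨10⟩ = true ∷ false ∷ []
pattern ⟨01⟩ = false ∷ true ∷ []
pattern ⟨11⟩ = true ∷ true ∷ []

F₂²-⊕-of-distinct-nonzero : (c d e : V 2) → c ≢ 𝟎 → d ≢ 𝟎 → e ≢ 𝟎 → c ≢ d → c ≢ e → d ≢ e →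
                            c ⊕ d ≡ e
F₂²-⊕-of-distinct-nonzero ⟨00⟩ _ _ c≢𝟎 _ _ _ _ _ = contradiction refl c≢𝟎
F₂²-⊕-of-distinct-nonzero _ ⟨00⟩ _ _ d≢𝟎 _ _ _ _ = contradiction refl d≢𝟎
F₂²-⊕-of-distinct-nonzero _ _ ⟨00⟩ _ _ e≢𝟎 _ _ _ = contradiction refl e≢𝟎
F₂²-⊕-of-distinct-nonzero ⟨10⟩ ⟨10⟩ _ _ _ _ c≢d _ _ = contradiction refl c≢d
F₂²-⊕-of-distinct-nonzero ⟨01⟩ ⟨01⟩ _ _ _ _ c≢d _ _ = contradiction refl c≢d
F₂²-⊕-of-distinct-nonzero ⟨11⟩ ⟨11⟩ _ _ _ _ c≢d _ _ = contradiction refl c≢d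
F₂²-⊕-of-distinct-nonzero ⟨10⟩ _ ⟨10⟩ _ _ _ _ c≢e _ = contradiction refl c≢e
F₂²-⊕-of-distinct-nonzero ⟨01⟩ _ ⟨01⟩ _ _ _ _ c≢e _ = contradiction refl c≢e
F₂²-⊕-of-distinct-nonzero ⟨11⟩ _ ⟨11⟩ _ _ _ _ c≢e _ = contradiction refl c≢e
F₂²-⊕-of-distinct-nonzero _ ⟨10⟩ ⟨10⟩ _ _ _ _ _ d≢e = contradiction refl d≢e
F₂²-⊕-of-distinct-nonzero _ ⟨01⟩ ⟨01⟩ _ _ _ _ _ d≢e = contradiction refl d≢e
F₂²-⊕-of-distinct-nonzero _ ⟨11⟩ ⟨11⟩ _ _ _ _ _ d≢e = contradiction refl d≢e
F₂²-⊕-of-distinct-nonzero ⟨10⟩ ⟨01⟩ ⟨11⟩ _ _ _ _ _ _ = refl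
F₂²-⊕-of-distinct-nonzero ⟨10⟩ ⟨11⟩ ⟨01⟩ _ _ _ _ _ _ = refl
F₂²-⊕-of-distinct-nonzero ⟨01⟩ ⟨10⟩ ⟨11⟩ _ _ _ _ _ _ = refl
F₂²-⊕-of-distinct-nonzero ⟨01⟩ ⟨11⟩ ⟨10⟩ _ _ _ _ _ _ = refl
F₂²-⊕-of-distinct-nonzero ⟨11⟩ ⟨10⟩ ⟨01⟩ _ _ _ _ _ _ = refl
F₂²-⊕-of-distinct-nonzero ⟨11⟩ ⟨01⟩ ⟨10⟩ _ _ _ _ _ _ = refl

-- Independence of the spanning pair is not needed: the coefficients live in F₂².
spans-two-⊕ : ∀ {v} {L : Subset v} {p q r : V v} (bs : Vec (V v) 2) → Spans bs L →
              L p → L q → L r → p ≢ 𝟎 → q ≢ 𝟎 → r ≢ 𝟎 → p ≢ q → p ≢ r → q ≢ r → p ⊕ q ≡ r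
spans-two-⊕ bs spans Lp Lq Lr p≢𝟎 q≢𝟎 r≢𝟎 p≢q p≢r q≢r
  with proj₁ (spans _) Lp | proj₁ (spans _) Lq | proj₁ (spans _) Lr
... | c , refl | d , refl | e , refl =
  trans (sym (comb-⊕ c d bs))
        (cong (λ f → comb f bs)
              (F₂²-⊕-of-distinct-nonzero c d e
                (nonzero p≢𝟎) (nonzero q≢𝟎) (nonzero r≢𝟎)
                (distinct p≢q) (distinct p≢r) (distinct q≢r)))
  where
    nonzero : ∀ {f} → comb f bs ≢ 𝟎 → f ≢ 𝟎
    nonzero comb≢𝟎 f≡𝟎 = comb≢𝟎 (trans (cong (λ f → comb f bs) f≡𝟎) (comb-𝟎 bs))
    distinct : ∀ {f g} → comb f bs ≢ comb g bs → f ≢ g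
    distinct combs≢ f≡g = combs≢ (cong (λ f → comb f bs) f≡g)

module _ {v : ℕ} {a b : V v} where

  comb-⟨10⟩ : comb ⟨10⟩ (a ∷ b ∷ []) ≡ a
  comb-⟨10⟩ = trans (cong (a ⊕_) (⊕-identityʳ 𝟎)) (⊕-identityʳ a)

  comb-⟨01⟩ : comb ⟨01⟩ (a ∷ b ∷ []) ≡ b
  comb-⟨01⟩ = trans (cong (𝟎 ⊕_) (⊕-identityʳ b)) (⊕-identityˡ b)

  comb-⟨11⟩ : comb ⟨11⟩ (a ∷ b ∷ []) ≡ a ⊕ b
  comb-⟨11⟩ = cong (a ⊕_) (⊕-identityʳ b)

  span-pair-points : ∀ {x} → Span (a ∷ b ∷ []) x → x ≡ 𝟎 ⊎ x ≡ a ⊎ x ≡ b ⊎ x ≡ a ⊕ b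
  span-pair-points (⟨00⟩ , refl) = inj₁ (comb-𝟎 (a ∷ b ∷ []))
  span-pair-points (⟨10⟩ , refl) = inj₂ (inj₁ comb-⟨10⟩)
  span-pair-points (⟨01⟩ , refl) = inj₂ (inj₂ (inj₁ comb-⟨01⟩))
  span-pair-points (⟨11⟩ , refl) = inj₂ (inj₂ (inj₂ comb-⟨11⟩))

  span-pair-isLine : a ≢ 𝟎 → b ≢ 𝟎 → a ≢ b → IsLine (Span (a ∷ b ∷ []))
  span-pair-isLine a≢𝟎 b≢𝟎 a≢b = (a ∷ b ∷ []) , independent , λ _ → (λ s → s) , (λ s → s)
    where
      independent : LinearlyIndependent (a ∷ b ∷ [])
      independent ⟨00⟩ _      = refl
      independent ⟨10⟩ comb≡𝟎 = contradiction (trans (sym comb-⟨10⟩) comb≡𝟎) a≢𝟎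
      independent ⟨01⟩ comb≡𝟎 = contradiction (trans (sym comb-⟨01⟩) comb≡𝟎) b≢𝟎
      independent ⟨11⟩ comb≡𝟎 = contradiction (x⊕y≡𝟎⇒x≡y (trans (sym comb-⟨11⟩) comb≡𝟎)) a≢b

module ThreeDisjointSubspaces {v : ℕ} (K : Fin 3 → Subset v)
  (K-subspace : ∀ i → IsSubspace (K i))
  (K-disjoint : ∀ i j → i ≢ j → Disjoint (K i) (K j)) where

  index-unique : ∀ {i j x} → x ≢ 𝟎 → K i x → K j x → i ≡ j
  index-unique {i} {j} {x} x≢𝟎 Kᵢx Kⱼx with i ≟ᶠ j
  ... | yes i≡j = i≡j
  ... | no  i≢j = contradiction (K-disjoint i j i≢j x Kᵢx Kⱼx) x≢𝟎

  Triad : (Fin 3 → V v) → Set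
  Triad p = (∀ i → K i (p i)) × p 0F ⊕ p 1F ≡ p 2F

  triad-𝟎 : Triad (λ _ → 𝟎)
  triad-𝟎 = (λ i → proj₁ (K-subspace i)) , ⊕-self 𝟎

  triad-⊕ : ∀ {p q} → Triad p → Triad q → Triad (λ i → p i ⊕ q i)
  triad-⊕ {p} {q} (p∈K , p-sum) (q∈K , q-sum) =
    (λ i → proj₂ (K-subspace i) _ _ (p∈K i) (q∈K i)) ,
    trans (⊕-interchange (p 0F) (q 0F) (p 1F) (q 1F)) (cong₂ _⊕_ p-sum q-sum)

  triad-collision : ∀ {p i j} → Triad p → i ≢ j → p i ≡ p j → p i ≡ 𝟎
  triad-collision {p} {i} {j} (p∈K , _) i≢j pᵢ≡pⱼ =
    K-disjoint i j i≢j (p i) (p∈K i) (subst (K j) (sym pᵢ≡pⱼ) (p∈K j))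

  all-zero : ∀ {p : Fin 3 → V v} → p 0F ≡ 𝟎 → p 1F ≡ 𝟎 → p 2F ≡ 𝟎 → ∀ j → p j ≡ 𝟎
  all-zero z₀ _  _  0F = z₀
  all-zero _  z₁ _  1F = z₁
  all-zero _  _  z₂ 2F = z₂

  triad-vanishes : ∀ {p} → Triad p → ∀ i → p i ≡ 𝟎 → ∀ j → p j ≡ 𝟎
  triad-vanishes {p} T@(_ , sum) 0F p₀≡𝟎 = all-zero p₀≡𝟎 p₁≡𝟎 (trans (sym p₁≡p₂) p₁≡𝟎)
    where
      p₁≡p₂ : p 1F ≡ p 2F
      p₁≡p₂ = trans (sym (⊕-identityˡ (p 1F))) (trans (cong (_⊕ p 1F) (sym p₀≡𝟎)) sum)
      p₁≡𝟎 : p 1F ≡ 𝟎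
      p₁≡𝟎 = triad-collision T (λ ()) p₁≡p₂
  triad-vanishes {p} T@(_ , sum) 1F p₁≡𝟎 = all-zero p₀≡𝟎 p₁≡𝟎 (trans (sym p₀≡p₂) p₀≡𝟎)
    where
      p₀≡p₂ : p 0F ≡ p 2F
      p₀≡p₂ = trans (sym (⊕-identityʳ (p 0F))) (trans (cong (p 0F ⊕_) (sym p₁≡𝟎)) sum)
      p₀≡𝟎 : p 0F ≡ 𝟎
      p₀≡𝟎 = triad-collision T (λ ()) p₀≡p₂
  triad-vanishes {p} T@(_ , sum) 2F p₂≡𝟎 = all-zero p₀≡𝟎 (trans (sym p₀≡p₁) p₀≡𝟎) p₂≡𝟎
    where
      p₀≡p₁ : p 0F ≡ p 1F
      p₀≡p₁ = x⊕y≡𝟎⇒x≡y (trans sum p₂≡𝟎)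
      p₀≡𝟎 : p 0F ≡ 𝟎
      p₀≡𝟎 = triad-collision T (λ ()) p₀≡p₁

  Transversal : Subset v → Set
  Transversal L = IsLine L × (∀ i → MeetsInExactlyOnePoint L (K i))

  module _ {L : Subset v} (t : Transversal L) where

    point : Fin 3 → V v
    point i = proj₁ (proj₂ t i)

    point≢𝟎 : ∀ i → point i ≢ 𝟎
    point≢𝟎 i = proj₁ (proj₂ (proj₂ t i))

    point∈L : ∀ i → L (point i)
    point∈L i = proj₁ (proj₂ (proj₂ (proj₂ t i)))

    point∈K : ∀ i → K i (point i)
    point∈K i = proj₁ (proj₂ (proj₂ (proj₂ (proj₂ t i))))

    point-unique : ∀ i {x} → x ≢ 𝟎 → L x → K i x → x ≡ point i
    point-unique i = proj₂ (proj₂ (proj₂ (proj₂ (proj₂ t i)))) _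

    point-distinct : ∀ {i j} → i ≢ j → point i ≢ point j
    point-distinct {i} {j} i≢j pᵢ≡pⱼ =
      i≢j (index-unique (point≢𝟎 i) (point∈K i) (subst (K j) (sym pᵢ≡pⱼ) (point∈K j)))

    points-sum : ∀ {x y z} → L x → L y → L z → x ≢ 𝟎 → y ≢ 𝟎 → z ≢ 𝟎 →
                 x ≢ y → x ≢ z → y ≢ z → x ⊕ y ≡ z
    points-sum = spans-two-⊕ (proj₁ (proj₁ t)) (proj₂ (proj₂ (proj₁ t)))

    triad : Triad point
    triad = point∈K ,
      points-sum (point∈L 0F) (point∈L 1F) (point∈L 2F) (point≢𝟎 0F) (point≢𝟎 1F) (point≢𝟎 2F)
                 (point-distinct (λ ())) (point-distinct (λ ())) (point-distinct (λ ()))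

    points : ∀ {x} → L x → x ≡ 𝟎 ⊎ ∃[ i ] x ≡ point i
    points {x} Lx with x ≟ᵛ 𝟎 | x ≟ᵛ point 0F | x ≟ᵛ point 1F
    ... | yes x≡𝟎 | _        | _        = inj₁ x≡𝟎
    ... | no _    | yes x≡p₀ | _        = inj₂ (0F , x≡p₀)
    ... | no _    | no _     | yes x≡p₁ = inj₂ (1F , x≡p₁)
    ... | no x≢𝟎 | no x≢p₀ | no x≢p₁ =
      inj₂ (2F , trans (sym (points-sum (point∈L 0F) (point∈L 1F) Lx (point≢𝟎 0F) (point≢𝟎 1F) x≢𝟎
                                        (point-distinct (λ ()))
                                        (≢-sym x≢p₀) (≢-sym x≢p₁)))
                       (proj₂ triad))

  transversal-⊆ : ∀ {L L′} (t : Transversal L) (t′ : Transversal L′) →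
                  (∀ i → point t i ≡ point t′ i) → ∀ {x} → L x → L′ x
  transversal-⊆ {L′ = L′} t t′ agree Lx with points t Lx
  ... | inj₁ refl       = proj₁ (isKSpace⇒isSubspace (proj₁ t′))
  ... | inj₂ (i , refl) = subst L′ (sym (agree i)) (point∈L t′ i)

  transversals-disjoint : ∀ {L L′} → Transversal L → Transversal L′ → ¬ SameSet L L′ →
                          Disjoint L L′
  transversals-disjoint t t′ L≉L′ x Lx L′x with points t Lx
  ... | inj₁ x≡𝟎 = x≡𝟎
  ... | inj₂ (i , x≡pᵢ) =
    contradiction (λ _ → transversal-⊆ t t′ agree , transversal-⊆ t′ t (λ j → sym (agree j))) L≉L′
    where
      x≢𝟎 : x ≢ 𝟎
      x≢𝟎 x≡𝟎 = point≢𝟎 t i (trans (sym x≡pᵢ) x≡𝟎)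
      x≡p′ᵢ : x ≡ point t′ i
      x≡p′ᵢ = point-unique t′ i x≢𝟎 L′x (subst (K i) (sym x≡pᵢ) (point∈K t i))
      difference-vanishes : point t i ⊕ point t′ i ≡ 𝟎
      difference-vanishes = trans (cong₂ _⊕_ (sym x≡pᵢ) (sym x≡p′ᵢ)) (⊕-self x)
      agree : ∀ j → point t j ≡ point t′ j
      agree j = x⊕y≡𝟎⇒x≡y (triad-vanishes (triad-⊕ (triad t) (triad t′)) i difference-vanishes j)

  TriadLine : (Fin 3 → V v) → Subset v
  TriadLine p = Span (p 0F ∷ p 1F ∷ [])

  module _ {p : Fin 3 → V v} (T : Triad p) where

    triadLine-∋ : ∀ i → TriadLine p (p i)
    triadLine-∋ 0F = ⟨10⟩ , comb-⟨10⟩ {b = p 1F}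
    triadLine-∋ 1F = ⟨01⟩ , comb-⟨01⟩ {a = p 0F}
    triadLine-∋ 2F = ⟨11⟩ , trans comb-⟨11⟩ (proj₂ T)

    triadLine-points : ∀ {x} → TriadLine p x → x ≡ 𝟎 ⊎ ∃[ i ] x ≡ p i
    triadLine-points Lx with span-pair-points Lx
    ... | inj₁ x≡𝟎                   = inj₁ x≡𝟎
    ... | inj₂ (inj₁ x≡p₀)           = inj₂ (0F , x≡p₀)
    ... | inj₂ (inj₂ (inj₁ x≡p₁))    = inj₂ (1F , x≡p₁)
    ... | inj₂ (inj₂ (inj₂ x≡p₀⊕p₁)) = inj₂ (2F , trans x≡p₀⊕p₁ (proj₂ T))

    triadLine-transversal : (∀ i → p i ≢ 𝟎) → Transversal (TriadLine p)
    triadLine-transversal p≢𝟎 =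
      span-pair-isLine (p≢𝟎 0F) (p≢𝟎 1F) (λ p₀≡p₁ → p≢𝟎 0F (triad-collision T (λ ()) p₀≡p₁)) ,
      λ i → p i , p≢𝟎 i , triadLine-∋ i , proj₁ T i , unique i
      where
        unique : ∀ i x → x ≢ 𝟎 → TriadLine p x → K i x → x ≡ p i
        unique i x x≢𝟎 Lx Kᵢx with triadLine-points Lx
        ... | inj₁ x≡𝟎        = contradiction x≡𝟎 x≢𝟎
        ... | inj₂ (j , refl) = cong p (index-unique x≢𝟎 (proj₁ T j) Kᵢx)

  TransversalTrace : Fin 3 → V v → Set₁
  TransversalTrace i x =
    x ≡ 𝟎 ⊎ Σ (Subset v) (λ L → IsLine L × (∀ j → MeetsInExactlyOnePoint L (K j)) × L x × K i x)

  TriadCoordinate : Fin 3 → V v → Set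
  TriadCoordinate i x = ∃[ p ] Triad p × p i ≡ x

  triadCoordinate-isSubspace : ∀ i → IsSubspace (TriadCoordinate i)
  triadCoordinate-isSubspace i =
    ((λ _ → 𝟎) , triad-𝟎 , refl) ,
    λ { _ _ (p , T , refl) (q , T′ , refl) → (λ j → p j ⊕ q j) , triad-⊕ T T′ , refl }

  trace⇒triadCoordinate : ∀ {i x} → TransversalTrace i x → TriadCoordinate i x
  trace⇒triadCoordinate (inj₁ refl) = (λ _ → 𝟎) , triad-𝟎 , refl
  trace⇒triadCoordinate {i} {x} (inj₂ (L , isLine , meets , Lx , Kᵢx)) with x ≟ᵛ 𝟎
  ... | yes refl = (λ _ → 𝟎) , triad-𝟎 , refl
  ... | no x≢𝟎   = point t , triad t , sym (point-unique t i x≢𝟎 Lx Kᵢx)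
    where
      t : Transversal L
      t = isLine , meets

  triadCoordinate⇒trace : ∀ {i x} → TriadCoordinate i x → TransversalTrace i x
  triadCoordinate⇒trace {i} (p , T , refl) with p i ≟ᵛ 𝟎
  ... | yes pᵢ≡𝟎 = inj₁ pᵢ≡𝟎
  ... | no pᵢ≢𝟎  =
    inj₂ (TriadLine p , proj₁ line , proj₂ line , triadLine-∋ T i , proj₁ T i)
    where
      line : Transversal (TriadLine p)
      line = triadLine-transversal T λ j pⱼ≡𝟎 → pᵢ≢𝟎 (triad-vanishes T j pⱼ≡𝟎 i)

  transversalTrace-isSubspace : ∀ i → IsSubspace (TransversalTrace i)
  transversalTrace-isSubspace i =
    isSubspace-transport triadCoordinate⇒trace trace⇒triadCoordinate (triadCoordinate-isSubspace i)

lemma13 : (v k : ℕ) → k ≥ 3 → (K : Fin 3 → Subset v)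
    → (∀ i → IsKSpace k (K i))
    → (∀ i j → i ≢ j → Disjoint (K i) (K j))
    → (∀ L L′ → IsLine L → (∀ i → MeetsInExactlyOnePoint L (K i))
              → IsLine L′ → (∀ i → MeetsInExactlyOnePoint L′ (K i))
              → ¬ SameSet L L′ → Disjoint L L′)
      × (∀ i → IsSubspace (λ x → x ≡ 𝟎 ⊎ Σ (Subset v) (λ L → IsLine L × (∀ j → MeetsInExactlyOnePoint L (K j)) × L x × K i x)))
lemma13 v k _ K K-kSpace K-disjoint =
  (λ _ _ isLine meets isLine′ meets′ → transversals-disjoint (isLine , meets) (isLine′ , meets′)) ,
  transversalTrace-isSubspace
  where
    open ThreeDisjointSubspaces K (λ i → isKSpace⇒isSubspace (K-kSpace i)) K-disjoint
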